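{- (Classification for $\mathbf{KP}$.) Let $\Gamma_\neg$ be a negated typing context and let $\Gamma_\neg\vdash_{\mathbf{KP}} t:A$ with $t$ in normal form and $t$ not $\neg$neutral. Then: if $A=B\to C$, $t$ is an abstraction or a variable declared in $\Gamma_\neg$; if $A=B\lor C$, $t$ is an injection $\mathtt{in}_i t'$; if $A=B\land C$, $t$ is a pair $\langle t_1,t_2\rangle$; if $A=\bot$, then $t=x\,s$ for some term $s$ and some variable $x$ declared in $\Gamma_\neg$.
   Context: Formulas are built from propositional atoms and $\bot$ using $\to,\land,\lor$; $\neg B$ abbreviates $B\to\bot$. $\mathbf{KP}$-terms: $t,s,u ::= x \mid t\,s \mid \lambda x.t \mid \mathtt{efq}(t) \mid \langle t,s\rangle \mid \pi_i t \mid \mathtt{in}_i t \mid \mathtt{case}\ t\ [y.s_1]\ [y.s_2] \mid \mathtt{hop}(x.t,\ y.s_1,\ y.s_2)$ ($i\in\{1,2\}$), with $x$ bound in $t$ and $y$ in $s_1,s_2$ in $\mathtt{hop}$; $t\{x:=s\}$ is capture-avoiding substitution. $\Gamma\vdash_{\mathbf{KP}} t:A$ is derived by the standard natural-deduction rules of intuitionistic propositional logic (axiom for declared variables; $\lambda$ for $\to_I$; application for $\to_E$; pairs for $\land_I$; $\pi_i t:A_i$ from $t:A_1\land A_2$; $\mathtt{in}_i t:A_1\lor A_2$ from $t:A_i$; $\mathtt{case}\,t\,[y.s_1][y.s_2]:D$ from $\Gamma\vdash t:A_1\lor A_2$ and $\Gamma,y:A_i\vdash s_i:D$; $\mathtt{efq}(t):A$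 from $t:\bot$) plus the Harrop rule: from $\Gamma,x:\neg B\vdash t:A_1\lor A_2$, $\Gamma,y:\neg B\to A_1\vdash s_1:D$, $\Gamma,y:\neg B\to A_2\vdash s_2:D$ infer $\Gamma\vdash\mathtt{hop}(x.t,y.s_1,y.s_2):D$. Weak head contexts: $W::=\Box\mid W\,t\mid\pi_i W\mid\mathtt{case}\ W\ [y.s_1]\ [y.s_2]$. Top-level reduction: $(\lambda x.t)s\mapsto t\{x:=s\}$; $\pi_i\langle t_1,t_2\rangle\mapsto t_i$; $\mathtt{case}\,(\mathtt{in}_i t)\,[y.s_1][y.s_2]\mapsto s_i\{y:=t\}$; $\mathtt{hop}(x.\mathtt{in}_i t,y.s_1,y.s_2)\mapsto s_i\{y:=\lambda x.t\}$; $\mathtt{hop}(x.W\langle\mathtt{efq}(t)\rangle,y.s_1,y.s_2)\mapsto s_1\{y:=\lambda x.\mathtt{efq}(t)\}$; $\to_{\mathbf{KP}}$ is its closure under all term constructors, and normal form means no $\to_{\mathbf{KP}}$ step applies. A negated typing context has the form $\{x_1:\neg A_1,\dots,x_n:\neg A_n\}$. A term is $\neg$neutral if it has the form $W\langle\mathtt{efq}(s)\rangle$ for some weak head context $W$ and term $s$. -}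

module Defs where

open import Data.Nat using (ℕ; zero; suc)
open import Data.List using (List; []; _∷_)
open import Data.List.Relation.Unary.All using (All)
open import Data.Product using (Σ; ∃; _×_; _,_)
open import Relation.Binary.PropositionalEquality using (_≡_)

data Fm : Set where
  atom : ℕ → Fm
  ⊥'   : Fm
  _⇒_  : Fm → Fm → Fm
  _∧'_ : Fm → Fm → Fm
  _∨'_ : Fm → Fm → Fm

infixr 5 _⇒_

neg : Fm → Fm
neg B = B ⇒ ⊥'

-- KP-terms, de Bruijn indices (variable 0 = innermost binder)
-- lam t : λx.t ;  case t s₁ s₂ : y bound (index 0) in s₁,s₂ ;
-- hop t s₁ s₂ : x bound in t, y bound in s₁, s₂
data Tm : Set where
  var  : ℕ → Tm
  app  : Tm → Tm → Tm
  lam  : Tm → Tm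
  efq  : Tm → Tm
  pair : Tm → Tm → Tm
  π₁   : Tm → Tm
  π₂   : Tm → Tm
  in₁  : Tm → Tm
  in₂  : Tm → Tm
  case : Tm → Tm → Tm → Tm
  hop  : Tm → Tm → Tm → Tm

ext : (ℕ → ℕ) → ℕ → ℕ
ext ρ zero    = zero
ext ρ (suc n) = suc (ρ n)

rename : (ℕ → ℕ) → Tm → Tm
rename ρ (var x)        = var (ρ x)
rename ρ (app t s)      = app (rename ρ t) (rename ρ s)
rename ρ (lam t)        = lam (rename (ext ρ) t)
rename ρ (efq t)        = efq (rename ρ t)
rename ρ (pair t s)     = pair (rename ρ t) (rename ρ s)
rename ρ (π₁ t)         = π₁ (rename ρ t)
rename ρ (π₂ t)         = π₂ (rename ρ t)
rename ρ (in₁ t)        = in₁ (rename ρ t)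
rename ρ (in₂ t)        = in₂ (rename ρ t)
rename ρ (case t s₁ s₂) = case (rename ρ t) (rename (ext ρ) s₁) (rename (ext ρ) s₂)
rename ρ (hop t s₁ s₂)  = hop (rename (ext ρ) t) (rename (ext ρ) s₁) (rename (ext ρ) s₂)

exts : (ℕ → Tm) → ℕ → Tm
exts σ zero    = var zero
exts σ (suc n) = rename suc (σ n)

subst : (ℕ → Tm) → Tm → Tm
subst σ (var x)        = σ x
subst σ (app t s)      = app (subst σ t) (subst σ s)
subst σ (lam t)        = lam (subst (exts σ) t)
subst σ (efq t)        = efq (subst σ t)
subst σ (pair t s)     = pair (subst σ t) (subst σ s)
subst σ (π₁ t)         = π₁ (subst σ t)
subst σ (π₂ t)         = π₂ (subst σ t)
subst σ (in₁ t)        = in₁ (subst σ t)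
subst σ (in₂ t)        = in₂ (subst σ t)
subst σ (case t s₁ s₂) = case (subst σ t) (subst (exts σ) s₁) (subst (exts σ) s₂)
subst σ (hop t s₁ s₂)  = hop (subst (exts σ) t) (subst (exts σ) s₁) (subst (exts σ) s₂)

-- single substitution t{0 := s} (free variables above 0 shift down)
sub0 : Tm → ℕ → Tm
sub0 s zero    = s
sub0 s (suc n) = var n

_[_] : Tm → Tm → Tm
t [ s ] = subst (sub0 s) t

data WCtx : Set where
  □     : WCtx
  wapp  : WCtx → Tm → WCtx
  wπ₁   : WCtx → WCtx
  wπ₂   : WCtx → WCtx
  wcase : WCtx → Tm → Tm → WCtx

plug : WCtx → Tm → Tm
plug □ u             = u
plug (wapp W t) u    = app (plug W u) t
plug (wπ₁ W) u       = π₁ (plug W u)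
plug (wπ₂ W) u       = π₂ (plug W u)
plug (wcase W s₁ s₂) u = case (plug W u) s₁ s₂

data _↦_ : Tm → Tm → Set where
  β      : ∀ t s → app (lam t) s ↦ (t [ s ])
  π₁β    : ∀ t₁ t₂ → π₁ (pair t₁ t₂) ↦ t₁
  π₂β    : ∀ t₁ t₂ → π₂ (pair t₁ t₂) ↦ t₂
  case₁  : ∀ t s₁ s₂ → case (in₁ t) s₁ s₂ ↦ (s₁ [ t ])
  case₂  : ∀ t s₁ s₂ → case (in₂ t) s₁ s₂ ↦ (s₂ [ t ])
  hop₁   : ∀ t s₁ s₂ → hop (in₁ t) s₁ s₂ ↦ (s₁ [ lam t ])
  hop₂   : ∀ t s₁ s₂ → hop (in₂ t) s₁ s₂ ↦ (s₂ [ lam t ])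
  hopEfq : ∀ W t s₁ s₂ → hop (plug W (efq t)) s₁ s₂ ↦ (s₁ [ lam (efq t) ])

data _⟶_ : Tm → Tm → Set where
  top    : ∀ {t u} → t ↦ u → t ⟶ u
  appL   : ∀ {t t' s} → t ⟶ t' → app t s ⟶ app t' s
  appR   : ∀ {t s s'} → s ⟶ s' → app t s ⟶ app t s'
  lamC   : ∀ {t t'} → t ⟶ t' → lam t ⟶ lam t'
  efqC   : ∀ {t t'} → t ⟶ t' → efq t ⟶ efq t'
  pairL  : ∀ {t t' s} → t ⟶ t' → pair t s ⟶ pair t' s
  pairR  : ∀ {t s s'} → s ⟶ s' → pair t s ⟶ pair t s'
  π₁C    : ∀ {t t'} → t ⟶ t' → π₁ t ⟶ π₁ t'
  π₂C    : ∀ {t t'} → t ⟶ t' → π₂ t ⟶ π₂ t'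
  in₁C   : ∀ {t t'} → t ⟶ t' → in₁ t ⟶ in₁ t'
  in₂C   : ∀ {t t'} → t ⟶ t' → in₂ t ⟶ in₂ t'
  caseC₀ : ∀ {t t' s₁ s₂} → t ⟶ t' → case t s₁ s₂ ⟶ case t' s₁ s₂
  caseC₁ : ∀ {t s₁ s₁' s₂} → s₁ ⟶ s₁' → case t s₁ s₂ ⟶ case t s₁' s₂
  caseC₂ : ∀ {t s₁ s₂ s₂'} → s₂ ⟶ s₂' → case t s₁ s₂ ⟶ case t s₁ s₂'
  hopC₀  : ∀ {t t' s₁ s₂} → t ⟶ t' → hop t s₁ s₂ ⟶ hop t' s₁ s₂
  hopC₁  : ∀ {t s₁ s₁' s₂} → s₁ ⟶ s₁' → hop t s₁ s₂ ⟶ hop t s₁' s₂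
  hopC₂  : ∀ {t s₁ s₂ s₂'} → s₂ ⟶ s₂' → hop t s₁ s₂ ⟶ hop t s₁ s₂'

Normal : Tm → Set
Normal t = ∀ u → t ⟶ u → Data.Empty.⊥
  where import Data.Empty

NegNeutral : Tm → Set
NegNeutral t = Σ WCtx λ W → Σ Tm λ s → t ≡ plug W (efq s)

-- typing contexts: lists, index 0 = most recently declared
data _∋_∶_ : List Fm → ℕ → Fm → Set where
  here  : ∀ {Γ A} → (A ∷ Γ) ∋ zero ∶ A
  there : ∀ {Γ A B x} → Γ ∋ x ∶ A → (B ∷ Γ) ∋ suc x ∶ A

Declared : List Fm → ℕ → Set
Declared Γ x = Σ Fm λ C → Γ ∋ x ∶ C

data _⊢_∶_ : List Fm → Tm → Fm → Set where
  ax    : ∀ {Γ x A} → Γ ∋ x ∶ A → Γ ⊢ var x ∶ A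
  ⇒I    : ∀ {Γ t A B} → (A ∷ Γ) ⊢ t ∶ B → Γ ⊢ lam t ∶ (A ⇒ B)
  ⇒E    : ∀ {Γ t s A B} → Γ ⊢ t ∶ (A ⇒ B) → Γ ⊢ s ∶ A → Γ ⊢ app t s ∶ B
  ∧I    : ∀ {Γ t s A B} → Γ ⊢ t ∶ A → Γ ⊢ s ∶ B → Γ ⊢ pair t s ∶ (A ∧' B)
  ∧E₁   : ∀ {Γ t A B} → Γ ⊢ t ∶ (A ∧' B) → Γ ⊢ π₁ t ∶ A
  ∧E₂   : ∀ {Γ t A B} → Γ ⊢ t ∶ (A ∧' B) → Γ ⊢ π₂ t ∶ B
  ∨I₁   : ∀ {Γ t A B} → Γ ⊢ t ∶ A → Γ ⊢ in₁ t ∶ (A ∨' B)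
  ∨I₂   : ∀ {Γ t A B} → Γ ⊢ t ∶ B → Γ ⊢ in₂ t ∶ (A ∨' B)
  ∨E    : ∀ {Γ t s₁ s₂ A₁ A₂ D} → Γ ⊢ t ∶ (A₁ ∨' A₂) →
          (A₁ ∷ Γ) ⊢ s₁ ∶ D → (A₂ ∷ Γ) ⊢ s₂ ∶ D → Γ ⊢ case t s₁ s₂ ∶ D
  efqR  : ∀ {Γ t A} → Γ ⊢ t ∶ ⊥' → Γ ⊢ efq t ∶ A
  harrop : ∀ {Γ t s₁ s₂ B A₁ A₂ D} → (neg B ∷ Γ) ⊢ t ∶ (A₁ ∨' A₂) →
           ((neg B ⇒ A₁) ∷ Γ) ⊢ s₁ ∶ D → ((neg B ⇒ A₂) ∷ Γ) ⊢ s₂ ∶ D →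
           Γ ⊢ hop t s₁ s₂ ∶ D

NegCtx : List Fm → Set
NegCtx Γ = All (λ C → Σ Fm λ A → C ≡ neg A) Γ

module Submission where

-- The proof is a single structural induction on the typing derivation,
-- establishing that a normal, non-¬neutral term typed in a negated context
-- is "canonical": an introduction form of its type, a declared variable
-- (necessarily of negated type), or an application x s of a declared
-- variable (of type ⊥).  Two inheritance facts drive the elimination
-- cases: a term sitting in the head position of one weak-head frame
-- (argument of application, projection, case scrutinee) is again normal and
-- non-¬neutral.  The induction hypothesis then makes the head canonical, and
-- every canonical head of an eliminated type except a variable would form a
-- redex.  For the Harrop rule the scrutinee lives in the extended negated
-- context ¬B, Γ; it cannot be ¬neutral because hop(x.W⟨efq s⟩, …) is itself
-- a redex.

open import Defs
open import Data.List using (List)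
open import Data.Product using (Σ; _×_; _,_)
open import Data.Sum using (_⊎_; inj₁; inj₂)
open import Relation.Nullary using (¬_)
open import Relation.Binary.PropositionalEquality using (_≡_; refl)
open import Data.Nat using (ℕ)
open import Data.List.Relation.Unary.All using (All; _∷_)
open import Data.Empty using (⊥-elim)

lookupAll : ∀ {P : Fm → Set} {Γ x C} → All P Γ → Γ ∋ x ∶ C → P C
lookupAll (p ∷ _)  here      = p
lookupAll (_ ∷ ps) (there i) = lookupAll ps i

-- One layer of a weak head context: the elimination forms whose principal
-- argument is in head position.
data Frame : Set where
  fapp  : Tm → Frame
  fπ₁   : Frame
  fπ₂   : Frame
  fcase : Tm → Tm → Frame

fill : Frame → Tm → Tm
fill (fapp s)      t = app t s
fill fπ₁           t = π₁ t
fill fπ₂           t = π₂ t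
fill (fcase s₁ s₂) t = case t s₁ s₂

fill-cong : ∀ F {t t′} → t ⟶ t′ → fill F t ⟶ fill F t′
fill-cong (fapp s)      = appL
fill-cong fπ₁           = π₁C
fill-cong fπ₂           = π₂C
fill-cong (fcase s₁ s₂) = caseC₀

extend : Frame → WCtx → WCtx
extend (fapp s)      W = wapp W s
extend fπ₁           W = wπ₁ W
extend fπ₂           W = wπ₂ W
extend (fcase s₁ s₂) W = wcase W s₁ s₂

plug-extend : ∀ F W u → fill F (plug W u) ≡ plug (extend F W) u
plug-extend (fapp s)      W u = refl
plug-extend fπ₁           W u = refl
plug-extend fπ₂           W u = refl
plug-extend (fcase s₁ s₂) W u = refl

normal-head : ∀ F {t} → Normal (fill F t) → Normal t
normal-head F n u r = n _ (fill-cong F r)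

nonNeutral-head : ∀ F {t} → ¬ NegNeutral (fill F t) → ¬ NegNeutral t
nonNeutral-head F nn (W , s , refl) = nn (extend F W , s , plug-extend F W (efq s))

normal-hop : ∀ {t s₁ s₂} → Normal (hop t s₁ s₂) → Normal t
normal-hop n u r = n _ (hopC₀ r)

nonNeutral-hop : ∀ {t s₁ s₂} → Normal (hop t s₁ s₂) → ¬ NegNeutral t
nonNeutral-hop {s₁ = s₁} {s₂} n (W , s , refl) = n _ (top (hopEfq W s s₁ s₂))

data Canonical (Γ : List Fm) : Tm → Fm → Set where
  cLam  : ∀ t B C → Canonical Γ (lam t) (B ⇒ C)
  cVar  : ∀ x B → Declared Γ x → Canonical Γ (var x) (neg B)
  cPair : ∀ t s B C → Canonical Γ (pair t s) (B ∧' C)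
  cIn₁  : ∀ t B C → Canonical Γ (in₁ t) (B ∨' C)
  cIn₂  : ∀ t B C → Canonical Γ (in₂ t) (B ∨' C)
  cApp  : ∀ x s → Declared Γ x → Canonical Γ (app (var x) s) ⊥'

canonical : ∀ {Γ t A} → NegCtx Γ → Γ ⊢ t ∶ A →
            Normal t → ¬ NegNeutral t → Canonical Γ t A
canonical ng (ax {x = x} i) n nn with lookupAll ng i
... | B , refl = cVar x B (_ , i)
canonical ng (⇒I {t = t} d)          n nn = cLam t _ _
canonical ng (∧I {t = t} {s = s} d e) n nn = cPair t s _ _
canonical ng (∨I₁ {t = t} d)         n nn = cIn₁ t _ _
canonical ng (∨I₂ {t = t} d)         n nn = cIn₂ t _ _
canonical ng (efqR {t = t} d)        n nn = ⊥-elim (nn (□ , t , refl))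
canonical ng (⇒E {s = s} d e) n nn
  with canonical ng d (normal-head (fapp s) n) (nonNeutral-head (fapp s) nn)
... | cLam t _ _  = ⊥-elim (n _ (top (β t s)))
... | cVar x _ dx = cApp x s dx
canonical ng (∧E₁ d) n nn
  with canonical ng d (normal-head fπ₁ n) (nonNeutral-head fπ₁ nn)
... | cPair a b _ _ = ⊥-elim (n _ (top (π₁β a b)))
canonical ng (∧E₂ d) n nn
  with canonical ng d (normal-head fπ₂ n) (nonNeutral-head fπ₂ nn)
... | cPair a b _ _ = ⊥-elim (n _ (top (π₂β a b)))
canonical ng (∨E {s₁ = s₁} {s₂ = s₂} d _ _) n nn
  with canonical ng d (normal-head (fcase s₁ s₂) n) (nonNeutral-head (fcase s₁ s₂) nn)
... | cIn₁ a _ _ = ⊥-elim (n _ (top (case₁ a s₁ s₂)))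
... | cIn₂ a _ _ = ⊥-elim (n _ (top (case₂ a s₁ s₂)))
canonical ng (harrop {s₁ = s₁} {s₂ = s₂} {B = B} d _ _) n nn
  with canonical ((B , refl) ∷ ng) d (normal-hop n) (nonNeutral-hop n)
... | cIn₁ a _ _ = ⊥-elim (n _ (top (hop₁ a s₁ s₂)))
... | cIn₂ a _ _ = ⊥-elim (n _ (top (hop₂ a s₁ s₂)))

canonical-⇒ : ∀ {Γ t A} → Canonical Γ t A → ∀ B C → A ≡ (B ⇒ C) →
              (Σ Tm λ t′ → t ≡ lam t′) ⊎ (Σ ℕ λ x → Declared Γ x × t ≡ var x)
canonical-⇒ (cLam t _ _)  _ _ refl = inj₁ (t , refl)
canonical-⇒ (cVar x _ dx) _ _ refl = inj₂ (x , dx , refl)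

canonical-∨ : ∀ {Γ t A} → Canonical Γ t A → ∀ B C → A ≡ (B ∨' C) →
              (Σ Tm λ t′ → t ≡ in₁ t′) ⊎ (Σ Tm λ t′ → t ≡ in₂ t′)
canonical-∨ (cIn₁ t _ _) _ _ refl = inj₁ (t , refl)
canonical-∨ (cIn₂ t _ _) _ _ refl = inj₂ (t , refl)

canonical-∧ : ∀ {Γ t A} → Canonical Γ t A → ∀ B C → A ≡ (B ∧' C) →
              Σ Tm λ t₁ → Σ Tm λ t₂ → t ≡ pair t₁ t₂
canonical-∧ (cPair t s _ _) _ _ refl = t , s , refl

canonical-⊥ : ∀ {Γ t A} → Canonical Γ t A → A ≡ ⊥' →
              Σ ℕ λ x → Σ Tm λ s → Declared Γ x × t ≡ app (var x) s
canonical-⊥ (cApp x s dx) refl = x , s , dx , refl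

mainTheorem6 : (Γ : List Fm) (t : Tm) (A : Fm) → NegCtx Γ → Γ ⊢ t ∶ A →
    Normal t → ¬ NegNeutral t →
    ((B C : Fm) → A ≡ (B ⇒ C) →
    (Σ Tm λ t′ → t ≡ lam t′) ⊎ (Σ ℕ λ x → Declared Γ x × t ≡ var x))
    × ((B C : Fm) → A ≡ (B ∨' C) →
    (Σ Tm λ t′ → t ≡ in₁ t′) ⊎ (Σ Tm λ t′ → t ≡ in₂ t′))
    × ((B C : Fm) → A ≡ (B ∧' C) →
    Σ Tm λ t₁ → Σ Tm λ t₂ → t ≡ pair t₁ t₂)
    × (A ≡ ⊥' →
    Σ ℕ λ x → Σ Tm λ s → Declared Γ x × t ≡ app (var x) s)
mainTheorem6 Γ t A ng d n nn =
  canonical-⇒ c , canonical-∨ c , canonical-∧ c , canonical-⊥ c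
  where
    c : Canonical Γ t A
    c = canonical ng d n nn
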